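{- Let $q$ be a prime power and $n\ge1$. The number $a_n$ of ordered pairs $(f,g)$ of coprime monic polynomials in $\mathbb{F}_q[X]$ of degree $n$, both with nonzero constant term, is $$a_n=q(q-1)^3\frac{q^{2n-2}-1}{q^2-1}+(q-1)(q-2).$$ -}

module Defs where

open import Level using (0ℓ)
open import Data.Nat using (ℕ)
open import Data.Fin using (Fin)
open import Data.Product using (Σ; ∃; _×_)
open import Data.List using (List; []; _∷_; map; _++_; [_])
open import Data.List.Relation.Unary.All using (All)
open import Data.Vec using (Vec; toList)
open import Data.Empty using (⊥)
open import Relation.Nullary using (¬_)
open import Relation.Binary.PropositionalEquality using (_≡_; _≢_)
open import Algebra.Structures using (IsCommutativeRing)
open import Function.Bundles using (_↔_)

record FiniteField (q : ℕ) : Set₁ where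
  field
    Carrier : Set
    _+_ _*_ : Carrier → Carrier → Carrier
    -_ : Carrier → Carrier
    0# 1# : Carrier
    isCommutativeRing : IsCommutativeRing _≡_ _+_ _*_ -_ 0# 1#
    0≢1 : 0# ≢ 1#
    inverse : ∀ x → x ≢ 0# → Σ Carrier (λ y → x * y ≡ 1#)
    card : Carrier ↔ Fin q

module Poly {q : ℕ} (F : FiniteField q) where
  open FiniteField F

  -- Polynomials as little-endian coefficient lists (c₀ ∷ c₁ ∷ …).
  Pol : Set
  Pol = List Carrier

  _+P_ : Pol → Pol → Pol
  [] +P ys = ys
  (x ∷ xs) +P [] = x ∷ xs
  (x ∷ xs) +P (y ∷ ys) = (x + y) ∷ (xs +P ys)

  scale : Carrier → Pol → Pol
  scale c = map (c *_)

  _*P_ : Pol → Pol → Pol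
  [] *P ys = []
  (x ∷ xs) *P ys = scale x ys +P (0# ∷ (xs *P ys))

  -- Equality of polynomials (coefficientwise, ignoring trailing zeros).
  _≈P_ : Pol → Pol → Set
  [] ≈P ys = All (_≡ 0#) ys
  (x ∷ xs) ≈P [] = All (_≡ 0#) (x ∷ xs)
  (x ∷ xs) ≈P (y ∷ ys) = (x ≡ y) × (xs ≈P ys)

  _∣P_ : Pol → Pol → Set
  h ∣P f = Σ Pol (λ k → (h *P k) ≈P f)

  IsUnit : Pol → Set
  IsUnit h = Σ Carrier (λ c → (c ≢ 0#) × (h ≈P [ c ]))

  Coprime : Pol → Pol → Set
  Coprime f g = ∀ h → h ∣P f → h ∣P g → IsUnit h

  -- The monic polynomial of degree n with lower coefficients c₀,…,c_{n-1}.
  monic : {n : ℕ} → Vec Carrier n → Pol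
  monic v = toList v ++ [ 1# ]

  constTerm : Pol → Carrier
  constTerm [] = 0#
  constTerm (x ∷ _) = x

{-# OPTIONS --safe #-}
module Submission where

-- Coprimality of f with a monic g only depends on f modulo g: subtracting X^j g is a
-- bijection from the monic polynomials of degree j + deg g onto the polynomials of smaller
-- degree, and scaling by a nonzero constant changes nothing.  Counting along these two moves
-- shows that there are (q - 1) q^(a+b-1) coprime pairs of monic polynomials of degrees a, b ≥ 1.
-- The constant-term conditions are handled by splitting on f(0): X f′ is coprime to g iff
-- g(0) ≠ 0 and f′ is coprime to g.  This gives recurrences along the diagonal a = b, first
-- for the pairs with g(0) ≠ 0 and then for those with f(0) ≠ 0 and g(0) ≠ 0.

open import Defs
open import Level using (0ℓ)
open import Algebra.Bundles using (CommutativeRing)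
open import Algebra.Structures using (IsCommutativeRing)
open import Data.Empty using (⊥-elim)
open import Data.Fin as Fin using (Fin)
import Data.Fin.Properties as Finₚ
open import Data.List as List
  using (List; []; _∷_; _++_; [_]; length; filter; tabulate; cartesianProductWith; cartesianProduct)
open import Data.List.Membership.Propositional using (_∈_)
import Data.List.Membership.Propositional.Properties as ∈ₚ
open import Data.List.Relation.Unary.All using (All; []; _∷_)
import Data.List.Relation.Unary.AllPairs as AllPairs
open import Data.List.Relation.Unary.Any using (here)
open import Data.List.Relation.Unary.Unique.Propositional using (Unique)
import Data.List.Relation.Unary.Unique.Propositional.Properties as Uniqueₚ
open import Data.Nat as ℕ using (ℕ; zero; suc; s≤s; z≤n)
import Data.Nat.Properties as ℕₚ
open import Data.Nat.Tactic.RingSolver using (solve-∀)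
open import Data.Product using (Σ; _×_; _,_; proj₁; proj₂)
open import Data.Sum using (_⊎_; inj₁; inj₂)
open import Data.Vec as Vec using (Vec; []; _∷_; _∷ʳ_)
import Data.Vec.Properties as Vecₚ
open import Function.Base using (_∘_)
open import Function.Bundles using (_↔_; Inverse; _⇔_; mk⇔; mk↔ₛ′; Equivalence)
open import Function.Construct.Composition using (_↔-∘_; _⇔-∘_)
open import Function.Construct.Symmetry using (↔-sym; ⇔-sym)
open import Function.Properties.Inverse using (↔⇒↣)
open import Function.Related.TypeIsomorphisms using (¬-cong-⇔)
open import Relation.Binary.Bundles using (Setoid)
open import Relation.Binary.Definitions using (DecidableEquality)
open import Relation.Binary.PropositionalEquality hiding ([_])
import Relation.Binary.Reasoning.Setoid as SetoidReasoning
open import Relation.Nullary using (¬_; Dec; yes; no)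
open import Relation.Nullary.Decidable using (¬?; _×-dec_; via-injection) renaming (map to Dec-map)
open import Relation.Unary using (Pred; Decidable)

data Comparison : ℕ → ℕ → Set where
  at-least : ∀ j m → Comparison (j ℕ.+ m) m
  less     : ∀ j k → Comparison k (suc (j ℕ.+ k))

compare′ : ∀ k m → Comparison k m
compare′ k m with m ℕ.≤? k
... | yes m≤k = subst (λ x → Comparison x m) (ℕₚ.m∸n+n≡m m≤k) (at-least (k ℕ.∸ m) m)
... | no m≰k  = subst (Comparison k) k<m⇒m≡ (less (m ℕ.∸ suc k) k)
  where
  k<m⇒m≡ : suc (m ℕ.∸ suc k ℕ.+ k) ≡ m
  k<m⇒m≡ = trans (sym (ℕₚ.+-suc (m ℕ.∸ suc k) k)) (ℕₚ.m∸n+n≡m (ℕₚ.≰⇒> m≰k))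

𝟙 : {P : Set} → Dec P → ℕ
𝟙 (yes _) = 1
𝟙 (no _)  = 0

𝟙-cong : {P Q : Set} → P ⇔ Q → (p? : Dec P) (q? : Dec Q) → 𝟙 p? ≡ 𝟙 q?
𝟙-cong P⇔Q (yes p) (yes q) = refl
𝟙-cong P⇔Q (yes p) (no ¬q) = ⊥-elim (¬q (Equivalence.to P⇔Q p))
𝟙-cong P⇔Q (no ¬p) (yes q) = ⊥-elim (¬p (Equivalence.from P⇔Q q))
𝟙-cong P⇔Q (no ¬p) (no ¬q) = refl

𝟙-yes : {P : Set} → P → (p? : Dec P) → 𝟙 p? ≡ 1
𝟙-yes p (yes _) = refl
𝟙-yes p (no ¬p) = ⊥-elim (¬p p)

𝟙-no : {P : Set} → ¬ P → (p? : Dec P) → 𝟙 p? ≡ 0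
𝟙-no ¬p (yes p) = ⊥-elim (¬p p)
𝟙-no ¬p (no _)  = refl

𝟙-idem : {P : Set} (p? : Dec P) (k : ℕ) → 𝟙 p? ℕ.* (𝟙 p? ℕ.* k) ≡ 𝟙 p? ℕ.* k
𝟙-idem (yes _) k = ℕₚ.+-identityʳ (k ℕ.+ 0)
𝟙-idem (no _)  k = refl

𝟙-× : {P Q : Set} (p? : Dec P) (q? : Dec Q) → 𝟙 (p? ×-dec q?) ≡ 𝟙 p? ℕ.* 𝟙 q?
𝟙-× (yes p) (yes q) = refl
𝟙-× (yes p) (no ¬q) = refl
𝟙-× (no ¬p) q?      = refl

module FiniteSums {A : Set} {m : ℕ} (enum : A ↔ Fin m) where
  open import Data.Nat using (_+_; _*_; _^_)
  open import Algebra.Properties.Semiring.Sum ℕₚ.+-*-semiring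
    using (sum; sum-cong-≗; ∑-distrib-+; ∑-comm; *-distribˡ-sum; sum-remove; sum-permute)
  open ≡-Reasoning

  sum-const : ∀ n k → sum {n} (λ _ → k) ≡ n * k
  sum-const zero    k = refl
  sum-const (suc n) k = cong (k +_) (sum-const n k)

  sum-split : ∀ {n} (i : Fin n) (t : Fin n → ℕ) → sum t ≡ t i + sum (λ j → 𝟙 (¬? (j Fin.≟ i)) * t j)
  sum-split {suc n} i t = begin
    sum t                           ≡⟨ sum-remove {i = i} t ⟩
    t i + sum (t ∘ punch)           ≡⟨ cong (t i +_) (sum-cong-≗ (sym ∘ weight-1)) ⟩
    t i + sum (t′ ∘ punch)          ≡⟨ cong (λ z → t i + (z + sum (t′ ∘ punch))) (sym weight-0) ⟩
    t i + (t′ i + sum (t′ ∘ punch)) ≡⟨ cong (t i +_) (sym (sum-remove {i = i} t′)) ⟩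
    t i + sum t′                    ∎
    where
    punch = Fin.punchIn i
    t′ : Fin (suc n) → ℕ
    t′ j = 𝟙 (¬? (j Fin.≟ i)) * t j
    weight-0 : t′ i ≡ 0
    weight-0 with i Fin.≟ i
    ... | yes _  = refl
    ... | no i≢i = ⊥-elim (i≢i refl)
    weight-1 : ∀ j → t′ (punch j) ≡ t (punch j)
    weight-1 j with punch j Fin.≟ i
    ... | yes e = ⊥-elim (Finₚ.punchInᵢ≢i i j e)
    ... | no _  = ℕₚ.+-identityʳ _

  ∑List : {B : Set} → (B → ℕ) → List B → ℕ
  ∑List h []       = 0
  ∑List h (x ∷ xs) = h x + ∑List h xs

  ∑List-++ : {B : Set} (h : B → ℕ) (xs ys : List B) → ∑List h (xs ++ ys) ≡ ∑List h xs + ∑List h ys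
  ∑List-++ h []       ys = refl
  ∑List-++ h (x ∷ xs) ys = trans (cong (h x +_) (∑List-++ h xs ys)) (sym (ℕₚ.+-assoc (h x) _ _))

  ∑List-map : {B C : Set} (h : C → ℕ) (f : B → C) (xs : List B) → ∑List h (List.map f xs) ≡ ∑List (h ∘ f) xs
  ∑List-map h f []       = refl
  ∑List-map h f (x ∷ xs) = cong (h (f x) +_) (∑List-map h f xs)

  ∑List-cong : {B : Set} {h h′ : B → ℕ} → (∀ x → h x ≡ h′ x) → ∀ xs → ∑List h xs ≡ ∑List h′ xs
  ∑List-cong h≗h′ []       = refl
  ∑List-cong h≗h′ (x ∷ xs) = cong₂ _+_ (h≗h′ x) (∑List-cong h≗h′ xs)

  ∑List-cartesianProductWith : {B C D : Set} (h : D → ℕ) (f : B → C → D) (xs : List B) (ys : List C) →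
    ∑List h (cartesianProductWith f xs ys) ≡ ∑List (λ x → ∑List (λ y → h (f x y)) ys) xs
  ∑List-cartesianProductWith h f []       ys = refl
  ∑List-cartesianProductWith h f (x ∷ xs) ys = trans (∑List-++ h (List.map (f x) ys) _)
    (cong₂ _+_ (∑List-map h (f x) ys) (∑List-cartesianProductWith h f xs ys))

  ∑List-tabulate : {B : Set} {n : ℕ} (h : B → ℕ) (g : Fin n → B) → ∑List h (tabulate g) ≡ sum (h ∘ g)
  ∑List-tabulate {n = zero}  h g = refl
  ∑List-tabulate {n = suc n} h g = cong (h (g Fin.zero) +_) (∑List-tabulate h (g ∘ Fin.suc))

  length-filter : {B : Set} {P : Pred B 0ℓ} (P? : Decidable P) (xs : List B) → length (filter P? xs) ≡ ∑List (𝟙 ∘ P?) xs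
  length-filter P? []       = refl
  length-filter P? (x ∷ xs) with P? x
  ... | yes _ = cong suc (length-filter P? xs)
  ... | no _  = length-filter P? xs

  open Inverse enum

  _≟_ : DecidableEquality A
  _≟_ = via-injection (↔⇒↣ enum) Fin._≟_

  𝟙≢ : A → A → ℕ
  𝟙≢ a x = 𝟙 (¬? (x ≟ a))

  ∑ : (A → ℕ) → ℕ
  ∑ h = sum (h ∘ from)

  ∑-cong : ∀ {h h′} → (∀ x → h x ≡ h′ x) → ∑ h ≡ ∑ h′
  ∑-cong h≗h′ = sum-cong-≗ (h≗h′ ∘ from)

  ∑-+ : ∀ h h′ → ∑ (λ x → h x + h′ x) ≡ ∑ h + ∑ h′
  ∑-+ h h′ = ∑-distrib-+ (h ∘ from) (h′ ∘ from)

  ∑-*ˡ : ∀ k h → ∑ (λ x → k * h x) ≡ k * ∑ h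
  ∑-*ˡ k h = sym (*-distribˡ-sum k (h ∘ from))

  ∑-const : ∀ k → ∑ (λ _ → k) ≡ m * k
  ∑-const = sum-const m

  ∑-∑-comm : ∀ (H : A → A → ℕ) → ∑ (λ x → ∑ (λ y → H x y)) ≡ ∑ (λ y → ∑ (λ x → H x y))
  ∑-∑-comm H = ∑-comm (λ i j → H (from i) (from j))

  ∑-↔ : (π : A ↔ A) → ∀ h → ∑ (h ∘ Inverse.to π) ≡ ∑ h
  ∑-↔ π h = sym (begin
    ∑ h                              ≡⟨ sum-permute (h ∘ from) (enum ↔-∘ (π ↔-∘ ↔-sym enum)) ⟩
    sum (h ∘ from ∘ to ∘ πto ∘ from) ≡⟨ sum-cong-≗ (cong h ∘ strictlyInverseʳ ∘ πto ∘ from) ⟩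
    ∑ (h ∘ πto)                      ∎)
    where πto = Inverse.to π

  ∑-split : ∀ a h → ∑ h ≡ h a + ∑ (λ x → 𝟙≢ a x * h x)
  ∑-split a h = begin
    ∑ h
      ≡⟨ sum-split (to a) (h ∘ from) ⟩
    h (from (to a)) + sum (λ j → 𝟙 (¬? (j Fin.≟ to a)) * h (from j))
      ≡⟨ cong₂ _+_ (cong h (strictlyInverseʳ a)) (sum-cong-≗ weight) ⟩
    h a + ∑ (λ x → 𝟙≢ a x * h x) ∎
    where
    from≡a⇔≡to-a : ∀ j → (from j ≡ a) ⇔ (j ≡ to a)
    from≡a⇔≡to-a j = mk⇔ (λ e → trans (sym (strictlyInverseˡ j)) (cong to e))
                          (λ e → trans (cong from e) (strictlyInverseʳ a))
    weight : ∀ j → 𝟙 (¬? (j Fin.≟ to a)) * h (from j) ≡ 𝟙≢ a (from j) * h (from j)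
    weight j = cong (_* h (from j))
      (𝟙-cong (¬-cong-⇔ (⇔-sym (from≡a⇔≡to-a j))) (¬? (j Fin.≟ to a)) (¬? (from j ≟ a)))

  ∑Vec : ∀ n → (Vec A n → ℕ) → ℕ
  ∑Vec zero    h = h []
  ∑Vec (suc n) h = ∑ (λ x → ∑Vec n (λ v → h (x ∷ v)))

  ∑Vec-cong : ∀ n {h h′ : Vec A n → ℕ} → (∀ v → h v ≡ h′ v) → ∑Vec n h ≡ ∑Vec n h′
  ∑Vec-cong zero    h≗h′ = h≗h′ []
  ∑Vec-cong (suc n) h≗h′ = ∑-cong (λ x → ∑Vec-cong n (h≗h′ ∘ (x ∷_)))

  ∑Vec-+ : ∀ n (h h′ : Vec A n → ℕ) → ∑Vec n (λ v → h v + h′ v) ≡ ∑Vec n h + ∑Vec n h′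
  ∑Vec-+ zero    h h′ = refl
  ∑Vec-+ (suc n) h h′ = trans (∑-cong (λ x → ∑Vec-+ n (h ∘ (x ∷_)) (h′ ∘ (x ∷_))))
    (∑-+ (λ x → ∑Vec n (h ∘ (x ∷_))) (λ x → ∑Vec n (h′ ∘ (x ∷_))))

  ∑Vec-*ˡ : ∀ n k (h : Vec A n → ℕ) → ∑Vec n (λ v → k * h v) ≡ k * ∑Vec n h
  ∑Vec-*ˡ zero    k h = refl
  ∑Vec-*ˡ (suc n) k h = trans (∑-cong (λ x → ∑Vec-*ˡ n k (h ∘ (x ∷_)))) (∑-*ˡ k (λ x → ∑Vec n (h ∘ (x ∷_))))

  ∑Vec-const : ∀ n k → ∑Vec n (λ _ → k) ≡ m ^ n * k
  ∑Vec-const zero    k = sym (ℕₚ.+-identityʳ k)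
  ∑Vec-const (suc n) k = begin
    ∑ (λ _ → ∑Vec n (λ _ → k)) ≡⟨ ∑-cong (λ _ → ∑Vec-const n k) ⟩
    ∑ (λ _ → m ^ n * k)        ≡⟨ ∑-const (m ^ n * k) ⟩
    m * (m ^ n * k)            ≡⟨ ℕₚ.*-assoc m (m ^ n) k ⟨
    m ^ suc n * k              ∎

  ∑Vec-∑-comm : ∀ n (H : Vec A n → A → ℕ) → ∑Vec n (λ v → ∑ (H v)) ≡ ∑ (λ x → ∑Vec n (λ v → H v x))
  ∑Vec-∑-comm zero    H = refl
  ∑Vec-∑-comm (suc n) H = trans (∑-cong (λ y → ∑Vec-∑-comm n (H ∘ (y ∷_))))
    (∑-∑-comm (λ y x → ∑Vec n (λ v → H (y ∷ v) x)))

  ∑Vec-comm : ∀ a b (H : Vec A a → Vec A b → ℕ) →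
              ∑Vec a (λ u → ∑Vec b (λ v → H u v)) ≡ ∑Vec b (λ v → ∑Vec a (λ u → H u v))
  ∑Vec-comm zero    b H = refl
  ∑Vec-comm (suc a) b H = trans (∑-cong (λ x → ∑Vec-comm a b (H ∘ (x ∷_))))
    (sym (∑Vec-∑-comm b (λ v x → ∑Vec a (λ u → H (x ∷ u) v))))

  ∑Vec-∷ʳ : ∀ n (h : Vec A (suc n) → ℕ) → ∑Vec (suc n) h ≡ ∑ (λ x → ∑Vec n (λ v → h (v ∷ʳ x)))
  ∑Vec-∷ʳ zero    h = refl
  ∑Vec-∷ʳ (suc n) h = trans (∑-cong (λ y → ∑Vec-∷ʳ n (h ∘ (y ∷_))))
    (∑-∑-comm (λ y x → ∑Vec n (λ v → h (y ∷ (v ∷ʳ x)))))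

  ∑Vec-map-↔ : (π : A ↔ A) → ∀ n (h : Vec A n → ℕ) → ∑Vec n (h ∘ Vec.map (Inverse.to π)) ≡ ∑Vec n h
  ∑Vec-map-↔ π zero    h = refl
  ∑Vec-map-↔ π (suc n) h = trans (∑-cong (λ x → ∑Vec-map-↔ π n (h ∘ (Inverse.to π x ∷_))))
    (∑-↔ π (λ x → ∑Vec n (h ∘ (x ∷_))))

  ∑Vec-zipWith-↔ : {B : Set} (π : B → A ↔ A) → ∀ {n} (w : Vec B n) (h : Vec A n → ℕ) →
                   ∑Vec n (λ v → h (Vec.zipWith (λ x b → Inverse.to (π b) x) v w)) ≡ ∑Vec n h
  ∑Vec-zipWith-↔ π []      h = refl
  ∑Vec-zipWith-↔ π (b ∷ w) h = trans (∑-cong (λ x → ∑Vec-zipWith-↔ π w (h ∘ (Inverse.to (π b) x ∷_))))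
    (∑-↔ (π b) (λ x → ∑Vec _ (h ∘ (x ∷_))))

  elements : List A
  elements = tabulate from

  ∈-elements : ∀ x → x ∈ elements
  ∈-elements x = subst (_∈ elements) (strictlyInverseʳ x) (∈ₚ.∈-tabulate⁺ (to x))

  elements-unique : Unique elements
  elements-unique = Uniqueₚ.tabulate⁺ from-injective
    where
    from-injective : ∀ {i j} → from i ≡ from j → i ≡ j
    from-injective {i} {j} e = trans (sym (strictlyInverseˡ i)) (trans (cong to e) (strictlyInverseˡ j))

  vectors : ∀ n → List (Vec A n)
  vectors zero    = [ [] ]
  vectors (suc n) = cartesianProductWith _∷_ elements (vectors n)

  ∈-vectors : ∀ {n} (v : Vec A n) → v ∈ vectors n
  ∈-vectors []      = here refl
  ∈-vectors (x ∷ v) = ∈ₚ.∈-cartesianProductWith⁺ _∷_ (∈-elements x) (∈-vectors v)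

  vectors-unique : ∀ n → Unique (vectors n)
  vectors-unique zero    = [] AllPairs.∷ AllPairs.[]
  vectors-unique (suc n) = Uniqueₚ.cartesianProductWith⁺ _∷_ Vecₚ.∷-injective elements-unique (vectors-unique n)

  ∑List-vectors : ∀ n (h : Vec A n → ℕ) → ∑List h (vectors n) ≡ ∑Vec n h
  ∑List-vectors zero    h = ℕₚ.+-identityʳ _
  ∑List-vectors (suc n) h = begin
    ∑List h (cartesianProductWith _∷_ elements (vectors n))
      ≡⟨ ∑List-cartesianProductWith h _∷_ elements (vectors n) ⟩
    ∑List (λ x → ∑List (h ∘ (x ∷_)) (vectors n)) elements
      ≡⟨ ∑List-cong (λ x → ∑List-vectors n (h ∘ (x ∷_))) elements ⟩
    ∑List (λ x → ∑Vec n (h ∘ (x ∷_))) elements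
      ≡⟨ ∑List-tabulate (λ x → ∑Vec n (h ∘ (x ∷_))) from ⟩
    ∑Vec (suc n) h ∎

  module _ (a b : ℕ) {P : Pred (Vec A a × Vec A b) 0ℓ} (P? : Decidable P) where

    pairsSatisfying : List (Vec A a × Vec A b)
    pairsSatisfying = filter P? (cartesianProduct (vectors a) (vectors b))

    pairsSatisfying-unique : Unique pairsSatisfying
    pairsSatisfying-unique = Uniqueₚ.filter⁺ P? (Uniqueₚ.cartesianProduct⁺ (vectors-unique a) (vectors-unique b))

    ∈-pairsSatisfying : ∀ u v → ((u , v) ∈ pairsSatisfying) ⇔ P (u , v)
    ∈-pairsSatisfying u v = mk⇔
      (λ uv∈ → proj₂ (∈ₚ.∈-filter⁻ P? {xs = cartesianProduct (vectors a) (vectors b)} uv∈))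
      (∈ₚ.∈-filter⁺ P? (∈ₚ.∈-cartesianProduct⁺ (∈-vectors u) (∈-vectors v)))

    length-pairsSatisfying : length pairsSatisfying ≡ ∑Vec a (λ u → ∑Vec b (λ v → 𝟙 (P? (u , v))))
    length-pairsSatisfying = begin
      length pairsSatisfying
        ≡⟨ length-filter P? (cartesianProduct (vectors a) (vectors b)) ⟩
      ∑List (𝟙 ∘ P?) (cartesianProduct (vectors a) (vectors b))
        ≡⟨ ∑List-cartesianProductWith (𝟙 ∘ P?) _,_ (vectors a) (vectors b) ⟩
      ∑List (λ u → ∑List (λ v → 𝟙 (P? (u , v))) (vectors b)) (vectors a)
        ≡⟨ ∑List-cong (λ u → ∑List-vectors b _) (vectors a) ⟩
      ∑List (λ u → ∑Vec b (λ v → 𝟙 (P? (u , v)))) (vectors a)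
        ≡⟨ ∑List-vectors a _ ⟩
      ∑Vec a (λ u → ∑Vec b (λ v → 𝟙 (P? (u , v)))) ∎

module FieldProperties {q : ℕ} (F : FiniteField q) where
  open FiniteField F
  module R = IsCommutativeRing isCommutativeRing

  fieldRing : CommutativeRing 0ℓ 0ℓ
  fieldRing = record { Carrier = Carrier ; _≈_ = _≡_ ; _+_ = _+_ ; _*_ = _*_ ; -_ = -_ ; 0# = 0# ; 1# = 1#
                     ; isCommutativeRing = isCommutativeRing }

  open import Algebra.Properties.Ring (CommutativeRing.ring fieldRing) public using (-1*x≈-x)

  inv : ∀ x → x ≢ 0# → Carrier
  inv x x≢0 = proj₁ (inverse x x≢0)

  inv-*ˡ : ∀ x (x≢0 : x ≢ 0#) → inv x x≢0 * x ≡ 1#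
  inv-*ˡ x x≢0 = trans (R.*-comm _ x) (proj₂ (inverse x x≢0))

  inv-*-cancelˡ : ∀ x (x≢0 : x ≢ 0#) y → inv x x≢0 * (x * y) ≡ y
  inv-*-cancelˡ x x≢0 y = begin
    inv x x≢0 * (x * y)   ≡⟨ R.*-assoc _ x y ⟨
    (inv x x≢0 * x) * y   ≡⟨ cong (_* y) (inv-*ˡ x x≢0) ⟩
    1# * y                ≡⟨ R.*-identityˡ y ⟩
    y                     ∎
    where open ≡-Reasoning

  *-inv-cancelˡ : ∀ x (x≢0 : x ≢ 0#) y → x * (inv x x≢0 * y) ≡ y
  *-inv-cancelˡ x x≢0 y = begin
    x * (inv x x≢0 * y)   ≡⟨ R.*-assoc x _ y ⟨
    (x * inv x x≢0) * y   ≡⟨ cong (_* y) (proj₂ (inverse x x≢0)) ⟩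
    1# * y                ≡⟨ R.*-identityˡ y ⟩
    y                     ∎
    where open ≡-Reasoning

  *-cancelˡ-0# : ∀ {x y} → x ≢ 0# → x * y ≡ 0# → y ≡ 0#
  *-cancelˡ-0# {x} {y} x≢0 xy≡0 = trans (sym (inv-*-cancelˡ x x≢0 y)) (trans (cong (inv x x≢0 *_) xy≡0) (R.zeroʳ _))

  *-nonzero : ∀ {x y} → x ≢ 0# → y ≢ 0# → x * y ≢ 0#
  *-nonzero x≢0 y≢0 xy≡0 = y≢0 (*-cancelˡ-0# x≢0 xy≡0)

  _-_ : Carrier → Carrier → Carrier
  x - y = x + (- y)

  translation : Carrier → Carrier ↔ Carrier
  translation b = mk↔ₛ′ (_- b) (_+ b) (cancel b (- b) (R.-‿inverseʳ b)) (cancel (- b) b (R.-‿inverseˡ b))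
    where
    cancel : ∀ u v → u + v ≡ 0# → ∀ x → (x + u) + v ≡ x
    cancel u v u+v≡0 x = trans (R.+-assoc x u v) (trans (cong (x +_) u+v≡0) (R.+-identityʳ x))

  scaling : ∀ c → c ≢ 0# → Carrier ↔ Carrier
  scaling c c≢0 = mk↔ₛ′ (inv c c≢0 *_) (c *_) (inv-*-cancelˡ c c≢0) (*-inv-cancelˡ c c≢0)

module PolynomialRing {q : ℕ} (F : FiniteField q) where
  open FiniteField F
  open Poly F
  open FieldProperties F using (module R; fieldRing; -1*x≈-x)

  open import Algebra.Properties.CommutativeSemigroup (CommutativeRing.+-commutativeSemigroup fieldRing)
    using (interchange)

  coeff : Pol → ℕ → Carrier
  coeff []       i       = 0#
  coeff (x ∷ xs) zero    = x
  coeff (x ∷ xs) (suc i) = coeff xs i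

  IsZero : Pol → Set
  IsZero = All (_≡ 0#)

  IsZero⇒coeff≡0# : ∀ {p} → IsZero p → ∀ i → coeff p i ≡ 0#
  IsZero⇒coeff≡0# []         i       = refl
  IsZero⇒coeff≡0# (x≡0 ∷ p₀) zero    = x≡0
  IsZero⇒coeff≡0# (x≡0 ∷ p₀) (suc i) = IsZero⇒coeff≡0# p₀ i

  coeff≡0#⇒IsZero : ∀ p → (∀ i → coeff p i ≡ 0#) → IsZero p
  coeff≡0#⇒IsZero []      p₀ = []
  coeff≡0#⇒IsZero (x ∷ p) p₀ = p₀ zero ∷ coeff≡0#⇒IsZero p (p₀ ∘ suc)

  ≈P[]⇒IsZero : ∀ {p} → p ≈P [] → IsZero p
  ≈P[]⇒IsZero {[]}    _   = []
  ≈P[]⇒IsZero {x ∷ p} p₀ = p₀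

  IsZero⇒≈P[] : ∀ {p} → IsZero p → p ≈P []
  IsZero⇒≈P[] {[]}    _   = []
  IsZero⇒≈P[] {x ∷ p} p₀ = p₀

  ≈P⇒coeff≡ : ∀ {p r} → p ≈P r → ∀ i → coeff p i ≡ coeff r i
  ≈P⇒coeff≡ {[]}    {r}     r₀       i       = sym (IsZero⇒coeff≡0# r₀ i)
  ≈P⇒coeff≡ {x ∷ p} {[]}    p₀       i       = IsZero⇒coeff≡0# p₀ i
  ≈P⇒coeff≡ {x ∷ p} {y ∷ r} (x≡y , _) zero    = x≡y
  ≈P⇒coeff≡ {x ∷ p} {y ∷ r} (_ , p≈r) (suc i) = ≈P⇒coeff≡ p≈r i

  coeff≡⇒≈P : ∀ {p r} → (∀ i → coeff p i ≡ coeff r i) → p ≈P r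
  coeff≡⇒≈P {[]}    {r}     e = coeff≡0#⇒IsZero r (sym ∘ e)
  coeff≡⇒≈P {x ∷ p} {[]}    e = coeff≡0#⇒IsZero (x ∷ p) e
  coeff≡⇒≈P {x ∷ p} {y ∷ r} e = e zero , coeff≡⇒≈P (e ∘ suc)

  ≈P-refl : ∀ {p} → p ≈P p
  ≈P-refl = coeff≡⇒≈P (λ _ → refl)


  ≈P-sym : ∀ {p r} → p ≈P r → r ≈P p
  ≈P-sym p≈r = coeff≡⇒≈P (sym ∘ ≈P⇒coeff≡ p≈r)

  ≈P-trans : ∀ {p r s} → p ≈P r → r ≈P s → p ≈P s
  ≈P-trans p≈r r≈s = coeff≡⇒≈P (λ i → trans (≈P⇒coeff≡ p≈r i) (≈P⇒coeff≡ r≈s i))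

  ≈P-setoid : Setoid 0ℓ 0ℓ
  ≈P-setoid = record { Carrier = Pol ; _≈_ = _≈P_
                     ; isEquivalence = record { refl = ≈P-refl ; sym = ≈P-sym ; trans = ≈P-trans } }

  module ≈P-Reasoning = SetoidReasoning ≈P-setoid

  coeff-+P : ∀ a b i → coeff (a +P b) i ≡ coeff a i + coeff b i
  coeff-+P []      b       i       = sym (R.+-identityˡ _)
  coeff-+P (x ∷ a) []      i       = sym (R.+-identityʳ _)
  coeff-+P (x ∷ a) (y ∷ b) zero    = refl
  coeff-+P (x ∷ a) (y ∷ b) (suc i) = coeff-+P a b i

  coeff-scale : ∀ c a i → coeff (scale c a) i ≡ c * coeff a i
  coeff-scale c []      i       = sym (R.zeroʳ c)
  coeff-scale c (x ∷ a) zero    = refl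
  coeff-scale c (x ∷ a) (suc i) = coeff-scale c a i

  coeff₀-*P : ∀ a b → coeff (a *P b) 0 ≡ coeff a 0 * coeff b 0
  coeff₀-*P []      b = sym (R.zeroˡ _)
  coeff₀-*P (x ∷ a) b = trans (coeff-+P (scale x b) _ 0) (trans (R.+-identityʳ _) (coeff-scale x b 0))

  +P-cong : ∀ {a a′ b b′} → a ≈P a′ → b ≈P b′ → (a +P b) ≈P (a′ +P b′)
  +P-cong {a} {a′} {b} {b′} a≈a′ b≈b′ = coeff≡⇒≈P λ i → begin
    coeff (a +P b) i          ≡⟨ coeff-+P a b i ⟩
    coeff a i + coeff b i     ≡⟨ cong₂ _+_ (≈P⇒coeff≡ a≈a′ i) (≈P⇒coeff≡ b≈b′ i) ⟩
    coeff a′ i + coeff b′ i   ≡⟨ coeff-+P a′ b′ i ⟨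
    coeff (a′ +P b′) i        ∎
    where open ≡-Reasoning

  +P-comm : ∀ a b → (a +P b) ≈P (b +P a)
  +P-comm a b = coeff≡⇒≈P λ i → trans (coeff-+P a b i) (trans (R.+-comm _ _) (sym (coeff-+P b a i)))

  +P-assoc : ∀ a b c → ((a +P b) +P c) ≈P (a +P (b +P c))
  +P-assoc a b c = coeff≡⇒≈P λ i → begin
    coeff ((a +P b) +P c) i               ≡⟨ coeff-+P (a +P b) c i ⟩
    coeff (a +P b) i + coeff c i          ≡⟨ cong (_+ coeff c i) (coeff-+P a b i) ⟩
    (coeff a i + coeff b i) + coeff c i   ≡⟨ R.+-assoc _ _ _ ⟩
    coeff a i + (coeff b i + coeff c i)   ≡⟨ cong (coeff a i +_) (coeff-+P b c i) ⟨
    coeff a i + coeff (b +P c) i          ≡⟨ coeff-+P a (b +P c) i ⟨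
    coeff (a +P (b +P c)) i               ∎
    where open ≡-Reasoning

  +P-identityʳ : ∀ a → (a +P []) ≈P a
  +P-identityʳ a = coeff≡⇒≈P λ i → trans (coeff-+P a [] i) (R.+-identityʳ _)

  IsZero-+P-identityˡ : ∀ {z} a → IsZero z → (z +P a) ≈P a
  IsZero-+P-identityˡ {z} a z₀ = coeff≡⇒≈P λ i →
    trans (coeff-+P z a i) (trans (cong (_+ coeff a i) (IsZero⇒coeff≡0# z₀ i)) (R.+-identityˡ _))

  +P-swap : ∀ u v w → (u +P (v +P w)) ≈P (v +P (u +P w))
  +P-swap u v w = begin
    u +P (v +P w)  ≈⟨ +P-assoc u v w ⟨
    (u +P v) +P w  ≈⟨ +P-cong (+P-comm u v) ≈P-refl ⟩
    (v +P u) +P w  ≈⟨ +P-assoc v u w ⟩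
    v +P (u +P w)  ∎
    where open ≈P-Reasoning

  scale-cong : ∀ c {a a′} → a ≈P a′ → scale c a ≈P scale c a′
  scale-cong c {a} {a′} a≈a′ = coeff≡⇒≈P λ i →
    trans (coeff-scale c a i) (trans (cong (c *_) (≈P⇒coeff≡ a≈a′ i)) (sym (coeff-scale c a′ i)))

  scale-0# : ∀ a → IsZero (scale 0# a)
  scale-0# a = coeff≡0#⇒IsZero _ λ i → trans (coeff-scale 0# a i) (R.zeroˡ _)

  scale-1# : ∀ a → scale 1# a ≈P a
  scale-1# a = coeff≡⇒≈P λ i → trans (coeff-scale 1# a i) (R.*-identityˡ _)

  scale-scale : ∀ c d a → scale c (scale d a) ≈P scale (c * d) a
  scale-scale c d a = coeff≡⇒≈P λ i → begin
    coeff (scale c (scale d a)) i  ≡⟨ coeff-scale c (scale d a) i ⟩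
    c * coeff (scale d a) i        ≡⟨ cong (c *_) (coeff-scale d a i) ⟩
    c * (d * coeff a i)            ≡⟨ R.*-assoc _ _ _ ⟨
    (c * d) * coeff a i            ≡⟨ coeff-scale (c * d) a i ⟨
    coeff (scale (c * d) a) i      ∎
    where open ≡-Reasoning

  scale-distrib-+P : ∀ c a b → scale c (a +P b) ≈P (scale c a +P scale c b)
  scale-distrib-+P c a b = coeff≡⇒≈P λ i → begin
    coeff (scale c (a +P b)) i                    ≡⟨ coeff-scale c (a +P b) i ⟩
    c * coeff (a +P b) i                          ≡⟨ cong (c *_) (coeff-+P a b i) ⟩
    c * (coeff a i + coeff b i)                   ≡⟨ R.distribˡ c _ _ ⟩
    (c * coeff a i) + (c * coeff b i)             ≡⟨ cong₂ _+_ (coeff-scale c a i) (coeff-scale c b i) ⟨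
    coeff (scale c a) i + coeff (scale c b) i     ≡⟨ coeff-+P (scale c a) (scale c b) i ⟨
    coeff (scale c a +P scale c b) i              ∎
    where open ≡-Reasoning

  scale-distribʳ-+ : ∀ x y c → scale (x + y) c ≈P (scale x c +P scale y c)
  scale-distribʳ-+ x y c = coeff≡⇒≈P λ i → begin
    coeff (scale (x + y) c) i                  ≡⟨ coeff-scale (x + y) c i ⟩
    (x + y) * coeff c i                        ≡⟨ R.distribʳ _ x y ⟩
    (x * coeff c i) + (y * coeff c i)          ≡⟨ cong₂ _+_ (coeff-scale x c i) (coeff-scale y c i) ⟨
    coeff (scale x c) i + coeff (scale y c) i  ≡⟨ coeff-+P (scale x c) _ i ⟨
    coeff (scale x c +P scale y c) i           ∎
    where open ≡-Reasoning

  +P-interchange : ∀ s t u v → ((s +P t) +P (u +P v)) ≈P ((s +P u) +P (t +P v))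
  +P-interchange s t u v = coeff≡⇒≈P λ i → begin
    coeff ((s +P t) +P (u +P v)) i                      ≡⟨ coeff-+P (s +P t) _ i ⟩
    coeff (s +P t) i + coeff (u +P v) i                 ≡⟨ cong₂ _+_ (coeff-+P s t i) (coeff-+P u v i) ⟩
    (coeff s i + coeff t i) + (coeff u i + coeff v i)   ≡⟨ interchange _ _ _ _ ⟩
    (coeff s i + coeff u i) + (coeff t i + coeff v i)   ≡⟨ cong₂ _+_ (coeff-+P s u i) (coeff-+P t v i) ⟨
    coeff (s +P u) i + coeff (t +P v) i                 ≡⟨ coeff-+P (s +P u) _ i ⟨
    coeff ((s +P u) +P (t +P v)) i                      ∎
    where open ≡-Reasoning

  +P-−1#-cancelʳ : ∀ a b → ((a +P b) +P scale (- 1#) b) ≈P a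
  +P-−1#-cancelʳ a b = coeff≡⇒≈P λ i → begin
    coeff ((a +P b) +P scale (- 1#) b) i
      ≡⟨ coeff-+P (a +P b) _ i ⟩
    coeff (a +P b) i + coeff (scale (- 1#) b) i
      ≡⟨ cong₂ _+_ (coeff-+P a b i) (trans (coeff-scale (- 1#) b i) (-1*x≈-x _)) ⟩
    (coeff a i + coeff b i) + (- coeff b i)
      ≡⟨ R.+-assoc _ _ _ ⟩
    coeff a i + (coeff b i + (- coeff b i))
      ≡⟨ cong (coeff a i +_) (R.-‿inverseʳ _) ⟩
    coeff a i + 0#
      ≡⟨ R.+-identityʳ _ ⟩
    coeff a i ∎
    where open ≡-Reasoning

  open ≈P-Reasoning

  IsZero-*P : ∀ {a} b → IsZero a → IsZero (a *P b)
  IsZero-*P {[]}    b []          = []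
  IsZero-*P {x ∷ a} b (refl ∷ a₀) = ≈P[]⇒IsZero (begin
    scale 0# b +P (0# ∷ (a *P b))  ≈⟨ IsZero-+P-identityˡ _ (scale-0# b) ⟩
    0# ∷ (a *P b)                  ≈⟨ refl ∷ IsZero-*P b a₀ ⟩
    []                             ∎)

  *P-zeroʳ : ∀ a → IsZero (a *P [])
  *P-zeroʳ []      = []
  *P-zeroʳ (x ∷ a) = refl ∷ *P-zeroʳ a

  0∷-*P : ∀ a b → ((0# ∷ a) *P b) ≈P (0# ∷ (a *P b))
  0∷-*P a b = IsZero-+P-identityˡ _ (scale-0# b)

  [c]-*P : ∀ c a → ([ c ] *P a) ≈P scale c a
  [c]-*P c a = ≈P-trans (+P-cong {b = [ 0# ]} {b′ = []} ≈P-refl (refl ∷ [])) (+P-identityʳ (scale c a))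

  *P-congʳ : ∀ a {b b′} → b ≈P b′ → (a *P b) ≈P (a *P b′)
  *P-congʳ []      b≈b′ = []
  *P-congʳ (x ∷ a) b≈b′ = +P-cong (scale-cong x b≈b′) (refl , *P-congʳ a b≈b′)

  *P-congˡ : ∀ {a a′} b → a ≈P a′ → (a *P b) ≈P (a′ *P b)
  *P-congˡ {[]}    {a′}     b a′₀             = ≈P-sym (IsZero⇒≈P[] (IsZero-*P b a′₀))
  *P-congˡ {x ∷ a} {[]}     b a₀              = IsZero⇒≈P[] (IsZero-*P b a₀)
  *P-congˡ {x ∷ a} {y ∷ a′} b (refl , a≈a′) = +P-cong ≈P-refl (refl , *P-congˡ b a≈a′)


  *P-∷ : ∀ a y ys → (a *P (y ∷ ys)) ≈P (scale y a +P (0# ∷ (a *P ys)))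
  *P-∷ []      y ys = refl ∷ []
  *P-∷ (x ∷ a) y ys = cong (_+ 0#) (R.*-comm x y) , (begin
    scale x ys +P (a *P (y ∷ ys))                        ≈⟨ +P-cong ≈P-refl (*P-∷ a y ys) ⟩
    scale x ys +P (scale y a +P (0# ∷ (a *P ys)))       ≈⟨ +P-swap (scale x ys) (scale y a) _ ⟩
    scale y a +P (scale x ys +P (0# ∷ (a *P ys)))       ∎)

  *P-comm : ∀ a b → (a *P b) ≈P (b *P a)
  *P-comm []      b = ≈P-sym (IsZero⇒≈P[] (*P-zeroʳ b))
  *P-comm (x ∷ a) b = begin
    scale x b +P (0# ∷ (a *P b))  ≈⟨ +P-cong ≈P-refl (refl , *P-comm a b) ⟩
    scale x b +P (0# ∷ (b *P a))  ≈⟨ *P-∷ b x a ⟨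
    b *P (x ∷ a)                  ∎

  *P-distribʳ-+P : ∀ a b c → ((a +P b) *P c) ≈P ((a *P c) +P (b *P c))
  *P-distribʳ-+P []      b       c = ≈P-refl
  *P-distribʳ-+P (x ∷ a) []      c = ≈P-sym (+P-identityʳ _)
  *P-distribʳ-+P (x ∷ a) (y ∷ b) c = begin
    scale (x + y) c +P (0# ∷ ((a +P b) *P c))
      ≈⟨ +P-cong (scale-distribʳ-+ x y c) (sym (R.+-identityʳ 0#) , *P-distribʳ-+P a b c) ⟩
    (scale x c +P scale y c) +P ((0# ∷ (a *P c)) +P (0# ∷ (b *P c)))
      ≈⟨ +P-interchange (scale x c) (scale y c) _ _ ⟩
    (scale x c +P (0# ∷ (a *P c))) +P (scale y c +P (0# ∷ (b *P c)))
      ∎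

  *P-distribˡ-+P : ∀ a b c → (a *P (b +P c)) ≈P ((a *P b) +P (a *P c))
  *P-distribˡ-+P a b c = begin
    a *P (b +P c)          ≈⟨ *P-comm a (b +P c) ⟩
    (b +P c) *P a          ≈⟨ *P-distribʳ-+P b c a ⟩
    (b *P a) +P (c *P a)   ≈⟨ +P-cong (*P-comm b a) (*P-comm c a) ⟩
    (a *P b) +P (a *P c)   ∎

  scale-*P : ∀ c a b → (scale c a *P b) ≈P scale c (a *P b)
  scale-*P c []      b = []
  scale-*P c (x ∷ a) b = begin
    scale (c * x) b +P (0# ∷ (scale c a *P b))
      ≈⟨ +P-cong (≈P-sym (scale-scale c x b)) (sym (R.zeroʳ c) , scale-*P c a b) ⟩
    scale c (scale x b) +P scale c (0# ∷ (a *P b))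
      ≈⟨ scale-distrib-+P c (scale x b) _ ⟨
    scale c (scale x b +P (0# ∷ (a *P b))) ∎

  *P-assoc : ∀ a b c → ((a *P b) *P c) ≈P (a *P (b *P c))
  *P-assoc []      b c = []
  *P-assoc (x ∷ a) b c = begin
    (scale x b +P (0# ∷ (a *P b))) *P c           ≈⟨ *P-distribʳ-+P (scale x b) _ c ⟩
    (scale x b *P c) +P ((0# ∷ (a *P b)) *P c)    ≈⟨ +P-cong (scale-*P x b c) (0∷-*P (a *P b) c) ⟩
    scale x (b *P c) +P (0# ∷ ((a *P b) *P c))    ≈⟨ +P-cong ≈P-refl (refl , *P-assoc a b c) ⟩
    scale x (b *P c) +P (0# ∷ (a *P (b *P c)))    ∎

module Coprimality {q : ℕ} (F : FiniteField q) where
  open FiniteField F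
  open Poly F
  open FieldProperties F
  open PolynomialRing F
  open FiniteSums card using (_≟_)

  ∣P-respʳ : ∀ h {f f′} → h ∣P f → f ≈P f′ → h ∣P f′
  ∣P-respʳ h (k , hk≈f) f≈f′ = k , ≈P-trans hk≈f f≈f′

  ∣P-+P : ∀ h {a b} → h ∣P a → h ∣P b → h ∣P (a +P b)
  ∣P-+P h (k , hk≈a) (l , hl≈b) = k +P l , ≈P-trans (*P-distribˡ-+P h k l) (+P-cong hk≈a hl≈b)

  ∣P-*P : ∀ h p {b} → h ∣P b → h ∣P (p *P b)
  ∣P-*P h p {b} (k , hk≈b) = p *P k , (begin
    h *P (p *P k)   ≈⟨ *P-assoc h p k ⟨
    (h *P p) *P k   ≈⟨ *P-congˡ k (*P-comm h p) ⟩
    (p *P h) *P k   ≈⟨ *P-assoc p h k ⟩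
    p *P (h *P k)   ≈⟨ *P-congʳ p hk≈b ⟩
    p *P b          ∎)
    where open ≈P-Reasoning

  ∣P-refl : ∀ h → h ∣P h
  ∣P-refl h = [ 1# ] , ≈P-trans (*P-comm h [ 1# ]) (≈P-trans ([c]-*P 1# h) (scale-1# h))

  ∣P-[] : ∀ h → h ∣P []
  ∣P-[] h = [] , IsZero⇒≈P[] (*P-zeroʳ h)

  Coprime-congˡ : ∀ {f f′ g} → f ≈P f′ → Coprime f g ⇔ Coprime f′ g
  Coprime-congˡ f≈f′ = mk⇔ (λ f⊥g h h∣f′ → f⊥g h (∣P-respʳ h h∣f′ (≈P-sym f≈f′)))
                           (λ f′⊥g h h∣f → f′⊥g h (∣P-respʳ h h∣f f≈f′))

  Coprime-comm : ∀ {f g} → Coprime f g ⇔ Coprime g f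
  Coprime-comm = mk⇔ (λ f⊥g h h∣g h∣f → f⊥g h h∣f h∣g) (λ g⊥f h h∣f h∣g → g⊥f h h∣g h∣f)

  Coprime-+P*P : ∀ f p g → Coprime f g ⇔ Coprime (f +P (p *P g)) g
  Coprime-+P*P f p g = mk⇔
    (λ f⊥g h h∣f+pg h∣g → f⊥g h (∣P-respʳ h (∣P-+P h h∣f+pg (∣P-*P h (scale (- 1#) p) h∣g)) cancel) h∣g)
    (λ f+pg⊥g h h∣f h∣g → f+pg⊥g h (∣P-+P h h∣f (∣P-*P h p h∣g)) h∣g)
    where
    cancel : ((f +P (p *P g)) +P (scale (- 1#) p *P g)) ≈P f
    cancel = ≈P-trans (+P-cong ≈P-refl (scale-*P (- 1#) p g)) (+P-−1#-cancelʳ f (p *P g))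

  Coprime-scale : ∀ c f g → c ≢ 0# → Coprime (scale c f) g ⇔ Coprime f g
  Coprime-scale c f g c≢0 = mk⇔
    (λ cf⊥g h h∣f h∣g → cf⊥g h (∣P-respʳ h (∣P-*P h [ c ] h∣f) ([c]-*P c f)) h∣g)
    (λ f⊥g h h∣cf h∣g → f⊥g h (∣P-respʳ h (∣P-*P h [ inv c c≢0 ] h∣cf) unscale) h∣g)
    where
    unscale : ([ inv c c≢0 ] *P scale c f) ≈P f
    unscale = begin
      [ inv c c≢0 ] *P scale c f     ≈⟨ [c]-*P (inv c c≢0) (scale c f) ⟩
      scale (inv c c≢0) (scale c f)  ≈⟨ scale-scale (inv c c≢0) c f ⟩
      scale (inv c c≢0 * c) f        ≡⟨ cong (λ x → scale x f) (inv-*ˡ c c≢0) ⟩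
      scale 1# f                     ≈⟨ scale-1# f ⟩
      f                              ∎
      where open ≈P-Reasoning

  X : Pol
  X = 0# ∷ 1# ∷ []

  X-*P : ∀ p → (X *P p) ≈P (0# ∷ p)
  X-*P p = ≈P-trans (0∷-*P [ 1# ] p) (refl , ≈P-trans ([c]-*P 1# p) (scale-1# p))

  [1#]≉[] : ¬ ([ 1# ] ≈P [])
  [1#]≉[] (1≡0 ∷ []) = 0≢1 (sym 1≡0)

  ¬IsUnit-X : ¬ IsUnit X
  ¬IsUnit-X (c , _ , (_ , 1≈[])) = [1#]≉[] 1≈[]

  coeff₀≡0#⇒X∣P : ∀ p → coeff p 0 ≡ 0# → X ∣P p
  coeff₀≡0#⇒X∣P []      _    = ∣P-[] X
  coeff₀≡0#⇒X∣P (x ∷ p) x≡0 = p , ≈P-trans (X-*P p) (sym x≡0 , ≈P-refl)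

  ∣P-coeff₀-nonzero : ∀ h {g} → h ∣P g → coeff g 0 ≢ 0# → coeff h 0 ≢ 0#
  ∣P-coeff₀-nonzero h {g} (l , hl≈g) g₀≢0 h₀≡0 = g₀≢0 (begin
    coeff g 0              ≡⟨ ≈P⇒coeff≡ hl≈g 0 ⟨
    coeff (h *P l) 0       ≡⟨ coeff₀-*P h l ⟩
    coeff h 0 * coeff l 0  ≡⟨ cong (_* coeff l 0) h₀≡0 ⟩
    0# * coeff l 0         ≡⟨ R.zeroˡ _ ⟩
    0#                     ∎)
    where open ≡-Reasoning

  constTerm≡coeff₀ : ∀ p → constTerm p ≡ coeff p 0
  constTerm≡coeff₀ []      = refl
  constTerm≡coeff₀ (x ∷ p) = refl

  Coprime-0∷ : ∀ p g → Coprime (0# ∷ p) g ⇔ ((constTerm g ≢ 0#) × Coprime p g)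
  Coprime-0∷ p g = mk⇔
    (λ Xp⊥g → (λ g₀≡0 → ¬IsUnit-X (Xp⊥g X (p , X-*P p)
                                           (coeff₀≡0#⇒X∣P g (trans (sym (constTerm≡coeff₀ g)) g₀≡0))))
            , (λ h h∣p h∣g → Xp⊥g h (∣P-respʳ h (∣P-*P h X h∣p) (X-*P p)) h∣g))
    (λ { (g₀≢0 , p⊥g) h (k , hk≈Xp) h∣g →
         p⊥g h (divide-by-X {h} (∣P-coeff₀-nonzero h h∣g (g₀≢0 ∘ trans (constTerm≡coeff₀ g))) k hk≈Xp) h∣g })
    where
    divide-by-X : ∀ {h} → coeff h 0 ≢ 0# → ∀ k → (h *P k) ≈P (0# ∷ p) → h ∣P p
    divide-by-X {h} _ [] hk≈Xp with ≈P-trans (≈P-sym hk≈Xp) (IsZero⇒≈P[] (*P-zeroʳ h))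
    ... | _ ∷ p₀ = [] , ≈P-trans (IsZero⇒≈P[] (*P-zeroʳ h)) (≈P-sym (IsZero⇒≈P[] p₀))
    divide-by-X {h} h₀≢0 (x ∷ k) hk≈Xp = k , proj₂ (begin
      0# ∷ (h *P k)                  ≈⟨ IsZero-+P-identityˡ _ (scale-0# h) ⟨
      scale 0# h +P (0# ∷ (h *P k))  ≈⟨ *P-∷ h 0# k ⟨
      h *P (0# ∷ k)                  ≡⟨ cong (λ y → h *P (y ∷ k)) (sym x≡0) ⟩
      h *P (x ∷ k)                   ≈⟨ hk≈Xp ⟩
      0# ∷ p                         ∎)
      where
      open ≈P-Reasoning
      x≡0 : x ≡ 0#
      x≡0 = *-cancelˡ-0# h₀≢0 (trans (sym (coeff₀-*P h (x ∷ k))) (≈P⇒coeff≡ hk≈Xp 0))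

  HasDegree : Pol → ℕ → Set
  HasDegree p d = (coeff p d ≢ 0#) × (∀ i → d ℕ.< i → coeff p i ≡ 0#)

  zero-or-degree : ∀ p → IsZero p ⊎ Σ ℕ (HasDegree p)
  zero-or-degree []      = inj₁ []
  zero-or-degree (x ∷ p) with zero-or-degree p
  ... | inj₂ (d , p_d≢0 , above) = inj₂ (suc d , p_d≢0 , λ { zero () ; (suc i) (s≤s d<i) → above i d<i })
  ... | inj₁ p₀ with x ≟ 0#
  ...   | yes x≡0 = inj₁ (x≡0 ∷ p₀)
  ...   | no x≢0  = inj₂ (0 , x≢0 , λ { zero () ; (suc i) _ → IsZero⇒coeff≡0# p₀ i })

  coeff-*P-top : ∀ {d e} h k → (∀ i → d ℕ.< i → coeff h i ≡ 0#) → (∀ j → e ℕ.< j → coeff k j ≡ 0#) →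
                 coeff (h *P k) (d ℕ.+ e) ≡ coeff h d * coeff k e
  coeff-*P-top             []      k _      _      = sym (R.zeroˡ _)
  coeff-*P-top {zero}  {e} (x ∷ h) k above-h above-k = begin
    coeff (scale x k +P (0# ∷ (h *P k))) e          ≡⟨ coeff-+P (scale x k) _ e ⟩
    coeff (scale x k) e + coeff (0# ∷ (h *P k)) e   ≡⟨ cong₂ _+_ (coeff-scale x k e) (hk₀ e) ⟩
    (x * coeff k e) + 0#                            ≡⟨ R.+-identityʳ _ ⟩
    x * coeff k e                                   ∎
    where
    open ≡-Reasoning
    hk₀ : ∀ i → coeff (0# ∷ (h *P k)) i ≡ 0#
    hk₀ zero    = refl
    hk₀ (suc i) = IsZero⇒coeff≡0# (IsZero-*P k (coeff≡0#⇒IsZero h (λ i → above-h (suc i) (s≤s z≤n)))) i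
  coeff-*P-top {suc d} {e} (x ∷ h) k above-h above-k = begin
    coeff (scale x k +P (0# ∷ (h *P k))) (suc d ℕ.+ e)
      ≡⟨ coeff-+P (scale x k) _ (suc d ℕ.+ e) ⟩
    coeff (scale x k) (suc d ℕ.+ e) + coeff (h *P k) (d ℕ.+ e)
      ≡⟨ cong₂ _+_ xk-top (coeff-*P-top h k (λ i → above-h (suc i) ∘ s≤s) above-k) ⟩
    0# + (coeff h d * coeff k e)
      ≡⟨ R.+-identityˡ _ ⟩
    coeff h d * coeff k e ∎
    where
    open ≡-Reasoning
    xk-top : coeff (scale x k) (suc d ℕ.+ e) ≡ 0#
    xk-top = trans (coeff-scale x k _) (trans (cong (x *_) (above-k _ (s≤s (ℕₚ.m≤n+m e d)))) (R.zeroʳ x))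

  *P≈[1#]⇒IsUnit : ∀ h k → (h *P k) ≈P [ 1# ] → IsUnit h
  *P≈[1#]⇒IsUnit h k hk≈1 with zero-or-degree h | zero-or-degree k
  ... | inj₁ h₀ | _ =
    ⊥-elim ([1#]≉[] (≈P-trans (≈P-sym hk≈1) (IsZero⇒≈P[] (IsZero-*P k h₀))))
  ... | inj₂ _ | inj₁ k₀ =
    ⊥-elim ([1#]≉[] (≈P-trans (≈P-sym hk≈1) (≈P-trans (*P-comm h k) (IsZero⇒≈P[] (IsZero-*P h k₀)))))
  ... | inj₂ (suc d , h_d≢0 , above-h) | inj₂ (e , k_e≢0 , above-k) =
    ⊥-elim (*-nonzero h_d≢0 k_e≢0 (trans (sym (coeff-*P-top h k above-h above-k)) (≈P⇒coeff≡ hk≈1 (suc d ℕ.+ e))))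
  ... | inj₂ (zero , h₀≢0 , above-h) | inj₂ _ = coeff h 0 , h₀≢0 , coeff≡⇒≈P constant
    where
    constant : ∀ i → coeff h i ≡ coeff [ coeff h 0 ] i
    constant zero    = refl
    constant (suc i) = above-h (suc i) (s≤s z≤n)

  Coprime-[1#]ˡ : ∀ g → Coprime [ 1# ] g
  Coprime-[1#]ˡ g h (k , hk≈1) _ = *P≈[1#]⇒IsUnit h k hk≈1

  Coprime-[]-[1#] : Coprime [] [ 1# ]
  Coprime-[]-[1#] h _ (k , hk≈1) = *P≈[1#]⇒IsUnit h k hk≈1

  ¬IsZero-monic : ∀ {m} (v : Vec Carrier m) → ¬ IsZero (monic v)
  ¬IsZero-monic []      (1≡0 ∷ _) = 0≢1 (sym 1≡0)
  ¬IsZero-monic (x ∷ v) (_ ∷ v₀)  = ¬IsZero-monic v v₀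

  ¬Coprime-[]-monic : ∀ {m} (v : Vec Carrier (suc m)) → ¬ Coprime [] (monic v)
  ¬Coprime-[]-monic (x ∷ v) []⊥g with []⊥g (monic (x ∷ v)) (∣P-[] (monic (x ∷ v))) (∣P-refl (monic (x ∷ v)))
  ... | (c , _ , (_ , v≈[])) = ¬IsZero-monic v (≈P[]⇒IsZero v≈[])

module CoprimeDecision {q : ℕ} (F : FiniteField q) where
  open FiniteField F
  open Poly F
  open FieldProperties F
  open PolynomialRing F
  open Coprimality F
  open FiniteSums card using (_≟_)

  Xʲ : ℕ → Pol
  Xʲ j = monic (Vec.replicate j 0#)

  Xʲ-*P : ∀ j p → (Xʲ j *P p) ≈P (List.replicate j 0# ++ p)
  Xʲ-*P zero    p = ≈P-trans ([c]-*P 1# p) (scale-1# p)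
  Xʲ-*P (suc j) p = ≈P-trans (0∷-*P (Xʲ j) p) (refl , Xʲ-*P j p)

  padded : ∀ j {m} → Vec Carrier m → Vec Carrier (j ℕ.+ m)
  padded j g = Vec.replicate j 0# Vec.++ g

  reduce : ∀ j {m} → Vec Carrier (j ℕ.+ m) → Vec Carrier m → Vec Carrier (j ℕ.+ m)
  reduce j f g = Vec.zipWith _-_ f (padded j g)

  monic-padded : ∀ j {m} (g : Vec Carrier m) → monic (padded j g) ≡ List.replicate j 0# ++ monic g
  monic-padded zero    g = refl
  monic-padded (suc j) g = cong (0# ∷_) (monic-padded j g)

  monic-−-monic : ∀ {n} (f w : Vec Carrier n) → (monic f +P scale (- 1#) (monic w)) ≈P Vec.toList (Vec.zipWith _-_ f w)
  monic-−-monic []      []      = trans (cong (1# +_) (-1*x≈-x 1#)) (R.-‿inverseʳ 1#) ∷ []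
  monic-−-monic (x ∷ f) (y ∷ w) = cong (x +_) (-1*x≈-x y) , monic-−-monic f w

  monic-reduce : ∀ j {m} (f : Vec Carrier (j ℕ.+ m)) (g : Vec Carrier m) →
                 (monic f +P (scale (- 1#) (Xʲ j) *P monic g)) ≈P Vec.toList (reduce j f g)
  monic-reduce j f g = begin
    monic f +P (scale (- 1#) (Xʲ j) *P monic g)
      ≈⟨ +P-cong ≈P-refl (scale-*P (- 1#) (Xʲ j) (monic g)) ⟩
    monic f +P scale (- 1#) (Xʲ j *P monic g)
      ≈⟨ +P-cong ≈P-refl (scale-cong (- 1#) (Xʲ-*P j (monic g))) ⟩
    monic f +P scale (- 1#) (List.replicate j 0# ++ monic g)
      ≡⟨ cong (λ p → monic f +P scale (- 1#) p) (monic-padded j g) ⟨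
    monic f +P scale (- 1#) (monic (padded j g))
      ≈⟨ monic-−-monic f (padded j g) ⟩
    Vec.toList (reduce j f g) ∎
    where open ≈P-Reasoning

  Coprime-reduce : ∀ j {m} (f : Vec Carrier (j ℕ.+ m)) (g : Vec Carrier m) →
                   Coprime (monic f) (monic g) ⇔ Coprime (Vec.toList (reduce j f g)) (monic g)
  Coprime-reduce j f g = Coprime-congˡ (monic-reduce j f g) ⇔-∘ Coprime-+P*P (monic f) (scale (- 1#) (Xʲ j)) (monic g)

  toList-∷ʳ-0# : ∀ {k} (v : Vec Carrier k) → Vec.toList (v ∷ʳ 0#) ≈P Vec.toList v
  toList-∷ʳ-0# []      = refl ∷ []
  toList-∷ʳ-0# (x ∷ v) = refl , toList-∷ʳ-0# v

  Coprime-∷ʳ-0# : ∀ {k} (v : Vec Carrier k) {h} → Coprime (Vec.toList (v ∷ʳ 0#)) h ⇔ Coprime (Vec.toList v) h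
  Coprime-∷ʳ-0# v = Coprime-congˡ (toList-∷ʳ-0# v)

  normalise : ∀ {k} c → c ≢ 0# → Vec Carrier k → Vec Carrier k
  normalise c c≢0 = Vec.map (inv c c≢0 *_)

  toList-∷ʳ : ∀ {k} (v : Vec Carrier k) c (c≢0 : c ≢ 0#) → Vec.toList (v ∷ʳ c) ≈P scale c (monic (normalise c c≢0 v))
  toList-∷ʳ []      c c≢0 = sym (R.*-identityʳ c) , []
  toList-∷ʳ (x ∷ v) c c≢0 = sym (*-inv-cancelˡ c c≢0 x) , toList-∷ʳ v c c≢0

  Coprime-∷ʳ : ∀ {k m} (v : Vec Carrier k) c (c≢0 : c ≢ 0#) (g : Vec Carrier m) →
               Coprime (Vec.toList (v ∷ʳ c)) (monic g) ⇔ Coprime (monic (normalise c c≢0 v)) (monic g)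
  Coprime-∷ʳ v c c≢0 g = Coprime-scale c _ (monic g) c≢0 ⇔-∘ Coprime-congˡ (toList-∷ʳ v c c≢0)

  -- Euclid's algorithm; N bounds the total length k + m, which drops at every step.
  coprime-bounded? : ∀ N {k m} → k ℕ.+ m ℕ.≤ N → (r : Vec Carrier k) (g : Vec Carrier m) →
                     Dec (Coprime (Vec.toList r) (monic g))
  coprime-bounded? N       {zero}  {zero}  _ [] [] = yes Coprime-[]-[1#]
  coprime-bounded? N       {zero}  {suc m} _ [] g  = no (¬Coprime-[]-monic g)
  coprime-bounded? (suc N) {suc k} {m} (s≤s k+m≤N) r g with Vec.initLast r
  ... | v , c , refl with c ≟ 0#
  ...   | yes refl = Dec-map (⇔-sym (Coprime-∷ʳ-0# v)) (coprime-bounded? N k+m≤N v g)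
  ...   | no c≢0 with compare′ k m
  ...     | at-least j .m =
    Dec-map (⇔-sym (Coprime-∷ʳ v c c≢0 g)) (Dec-map (⇔-sym (Coprime-reduce j v′ g))
      (coprime-bounded? N k+m≤N (reduce j v′ g) g))
    where v′ = normalise c c≢0 v
  ...     | less j .k =
    Dec-map (⇔-sym (Coprime-∷ʳ v c c≢0 g)) (Dec-map Coprime-comm (Dec-map (⇔-sym (Coprime-reduce (suc j) g v′))
      (coprime-bounded? N (subst (ℕ._≤ N) (ℕₚ.+-comm k m) k+m≤N) (reduce (suc j) g v′) v′)))
    where v′ = normalise c c≢0 v

  coprime? : ∀ p {m} (g : Vec Carrier m) → Dec (Coprime p (monic g))
  coprime? p {m} g = subst (λ r → Dec (Coprime r (monic g))) (Vecₚ.toList∘fromList p)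
                           (coprime-bounded? (List.length p ℕ.+ m) ℕₚ.≤-refl (Vec.fromList p) g)

module Counting {r : ℕ} (F : FiniteField (suc (suc r))) where
  open import Data.Nat using (_+_; _*_; _^_; _∸_)
  open FiniteField F using (Carrier; 0#; 1#; 0≢1; card)
  open Poly F
  open FieldProperties F using (translation; scaling)
  open Coprimality F
  open CoprimeDecision F
  open FiniteSums card
  open ≡-Reasoning

  q p : ℕ
  q = suc (suc r)
  p = suc r

  p*q≡p+p*p : ∀ x → p * (q * x) ≡ p * x + p * (p * x)
  p*q≡p+p*p x = ℕₚ.*-distribˡ-+ p x (p * x)

  ∑-nonzero-const : ∀ k → ∑ (λ c → 𝟙≢ 0# c * k) ≡ p * k
  ∑-nonzero-const k = ℕₚ.+-cancelˡ-≡ k _ _ (trans (sym (∑-split 0# (λ _ → k))) (∑-const k))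

  ∑Vec²-*ˡ : ∀ a b k (H : Vec Carrier a → Vec Carrier b → ℕ) →
             ∑Vec a (λ u → ∑Vec b (λ v → k * H u v)) ≡ k * ∑Vec a (λ u → ∑Vec b (H u))
  ∑Vec²-*ˡ a b k H = trans (∑Vec-cong a (λ u → ∑Vec-*ˡ b k (H u))) (∑Vec-*ˡ a k _)

  -- A vector u : Vec Carrier k stands both for the polynomial Vec.toList u of degree < k
  -- and for the monic polynomial monic u of degree k.
  χ : ∀ {a b} → Vec Carrier a → Vec Carrier b → ℕ
  χ f g = 𝟙 (coprime? (monic f) g)

  χ-comm : ∀ {a b} (f : Vec Carrier a) (g : Vec Carrier b) → χ f g ≡ χ g f
  χ-comm f g = 𝟙-cong Coprime-comm (coprime? (monic f) g) (coprime? (monic g) f)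

  coprimeLow : ∀ k {m} → Vec Carrier m → ℕ
  coprimeLow k g = ∑Vec k (λ u → 𝟙 (coprime? (Vec.toList u) g))

  coprimeMonic : ∀ k {m} → Vec Carrier m → ℕ
  coprimeMonic k g = ∑Vec k (λ f → χ f g)

  coprimeLow-suc : ∀ k {m} (g : Vec Carrier m) → coprimeLow (suc k) g ≡ coprimeLow k g + p * coprimeMonic k g
  coprimeLow-suc k g = begin
    coprimeLow (suc k) g
      ≡⟨ ∑Vec-∷ʳ k (λ u → 𝟙 (coprime? (Vec.toList u) g)) ⟩
    ∑ (λ c → low c)
      ≡⟨ ∑-split 0# low ⟩
    low 0# + ∑ (λ c → 𝟙≢ 0# c * low c)
      ≡⟨ cong₂ _+_ drop-0# (∑-cong normalise-top) ⟩
    coprimeLow k g + ∑ (λ c → 𝟙≢ 0# c * coprimeMonic k g)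
      ≡⟨ cong (coprimeLow k g +_) (∑-nonzero-const _) ⟩
    coprimeLow k g + p * coprimeMonic k g ∎
    where
    low : Carrier → ℕ
    low c = ∑Vec k (λ u → 𝟙 (coprime? (Vec.toList (u ∷ʳ c)) g))
    drop-0# : low 0# ≡ coprimeLow k g
    drop-0# = ∑Vec-cong k (λ u → 𝟙-cong (Coprime-∷ʳ-0# u) _ _)
    normalise-top : ∀ c → 𝟙≢ 0# c * low c ≡ 𝟙≢ 0# c * coprimeMonic k g
    normalise-top c with c ≟ 0#
    ... | yes _  = refl
    ... | no c≢0 = cong (1 *_) (trans (∑Vec-cong k (λ u → 𝟙-cong (Coprime-∷ʳ u c c≢0 g) _ _))
                                      (∑Vec-map-↔ (scaling c c≢0) k (λ f → χ f g)))

  -- f ↦ f - X^j g maps the monic f of degree j + m bijectively onto the polynomials of degree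
  -- < j + m, preserving coprimality with g.
  coprimeMonic≡coprimeLow : ∀ j {m} (g : Vec Carrier m) → coprimeMonic (j + m) g ≡ coprimeLow (j + m) g
  coprimeMonic≡coprimeLow j g =
    trans (∑Vec-cong _ (λ f → 𝟙-cong (Coprime-reduce j f g) _ _))
          (∑Vec-zipWith-↔ translation (padded j g) (λ u → 𝟙 (coprime? (Vec.toList u) g)))

  coprimeLow-0-[] : coprimeLow 0 [] ≡ 1
  coprimeLow-0-[] = 𝟙-yes Coprime-[]-[1#] (coprime? [] [])

  coprimeLow-0-∷ : ∀ {m} (g : Vec Carrier (suc m)) → coprimeLow 0 g ≡ 0
  coprimeLow-0-∷ g = 𝟙-no (¬Coprime-[]-monic g) (coprime? [] g)

  lowPairs : ℕ → ℕ → ℕ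
  lowPairs k m = ∑Vec m (coprimeLow k)

  pairs : ℕ → ℕ → ℕ
  pairs a b = ∑Vec a (λ f → ∑Vec b (χ f))

  pairs-comm : ∀ a b → pairs a b ≡ pairs b a
  pairs-comm a b = trans (∑Vec-comm a b χ) (∑Vec-cong b (λ g → ∑Vec-cong a (λ f → χ-comm f g)))

  pairs≡lowPairs : ∀ j m → pairs (j + m) m ≡ lowPairs (j + m) m
  pairs≡lowPairs j m = trans (∑Vec-comm (j + m) m χ) (∑Vec-cong m (coprimeMonic≡coprimeLow j))

  lowPairs-suc : ∀ k m → lowPairs (suc k) m ≡ lowPairs k m + p * pairs k m
  lowPairs-suc k m = begin
    ∑Vec m (coprimeLow (suc k))
      ≡⟨ ∑Vec-cong m (coprimeLow-suc k) ⟩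
    ∑Vec m (λ g → coprimeLow k g + p * coprimeMonic k g)
      ≡⟨ ∑Vec-+ m _ _ ⟩
    lowPairs k m + ∑Vec m (λ g → p * coprimeMonic k g)
      ≡⟨ cong (lowPairs k m +_) (∑Vec-*ˡ m p _) ⟩
    lowPairs k m + p * ∑Vec m (coprimeMonic k)
      ≡⟨ cong (λ x → lowPairs k m + p * x) (∑Vec-comm m k (λ g f → χ f g)) ⟩
    lowPairs k m + p * pairs k m ∎

  lowPairsFormula : ℕ → ℕ → ℕ
  lowPairsFormula zero    zero    = 1
  lowPairsFormula zero    (suc m) = 0
  lowPairsFormula (suc k) zero    = q ^ suc k
  lowPairsFormula (suc k) (suc m) = p * q ^ suc (k + m)

  lowPairs-zero : ∀ m → lowPairs 0 m ≡ lowPairsFormula 0 m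
  lowPairs-zero zero    = coprimeLow-0-[]
  lowPairs-zero (suc m) = trans (∑Vec-cong (suc m) coprimeLow-0-∷) (trans (∑Vec-const (suc m) 0) (ℕₚ.*-zeroʳ (q ^ suc m)))

  lowPairsFormula-suc-≥ : ∀ j m → lowPairsFormula (suc (j + m)) m
                                  ≡ lowPairsFormula (j + m) m + p * lowPairsFormula (j + m) m
  lowPairsFormula-suc-≥ zero    zero    = refl
  lowPairsFormula-suc-≥ (suc j) zero    = refl
  lowPairsFormula-suc-≥ zero    (suc m) = p*q≡p+p*p (q ^ suc (m + m))
  lowPairsFormula-suc-≥ (suc j) (suc m) = p*q≡p+p*p (q ^ suc (j + suc m + m))

  lowPairsFormula-suc-< : ∀ j k → lowPairsFormula (suc k) (suc (j + k))
                                  ≡ lowPairsFormula k (suc (j + k)) + p * lowPairsFormula (suc (j + k)) k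
  lowPairsFormula-suc-< j zero    = refl
  lowPairsFormula-suc-< j (suc k) = begin
    p * (q * q ^ suc e)                                ≡⟨ p*q≡p+p*p (q ^ suc e) ⟩
    p * q ^ suc e + p * (p * q ^ suc e)                ≡⟨ cong (λ x → p * q ^ suc e + p * (p * q ^ suc x)) (ℕₚ.+-comm k _) ⟩
    p * q ^ suc e + p * (p * q ^ suc (j + suc k + k))  ∎
    where e = k + (j + suc k)

  lowPairs≡lowPairsFormula : ∀ s k m → k + m ≡ s → lowPairs k m ≡ lowPairsFormula k m
  lowPairs≡lowPairsFormula s       zero    m _ = lowPairs-zero m
  lowPairs≡lowPairsFormula (suc s) (suc k) m e with compare′ k m
  ... | at-least j .m = begin
    lowPairs (suc (j + m)) m
      ≡⟨ lowPairs-suc (j + m) m ⟩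
    lowPairs (j + m) m + p * pairs (j + m) m
      ≡⟨ cong (λ x → lowPairs (j + m) m + p * x) (pairs≡lowPairs j m) ⟩
    lowPairs (j + m) m + p * lowPairs (j + m) m
      ≡⟨ cong (λ x → x + p * x) (lowPairs≡lowPairsFormula s (j + m) m (ℕₚ.suc-injective e)) ⟩
    lowPairsFormula (j + m) m + p * lowPairsFormula (j + m) m
      ≡⟨ lowPairsFormula-suc-≥ j m ⟨
    lowPairsFormula (suc (j + m)) m ∎
  ... | less j .k = begin
    lowPairs (suc k) m
      ≡⟨ lowPairs-suc k m ⟩
    lowPairs k m + p * pairs k m
      ≡⟨ cong (λ x → lowPairs k m + p * x) (trans (pairs-comm k m) (pairs≡lowPairs (suc j) k)) ⟩
    lowPairs k m + p * lowPairs m k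
      ≡⟨ cong₂ (λ x y → x + p * y) (lowPairs≡lowPairsFormula s k m (ℕₚ.suc-injective e))
        (lowPairs≡lowPairsFormula s m k (trans (ℕₚ.+-comm m k) (ℕₚ.suc-injective e))) ⟩
    lowPairsFormula k m + p * lowPairsFormula m k
      ≡⟨ lowPairsFormula-suc-< j k ⟨
    lowPairsFormula (suc k) m ∎

  pairs≡lowPairsFormula : ∀ j m → pairs (j + m) m ≡ lowPairsFormula (j + m) m
  pairs≡lowPairsFormula j m = trans (pairs≡lowPairs j m) (lowPairs≡lowPairsFormula _ (j + m) m refl)

  pairs-diagonal : ∀ k → pairs (suc k) (suc k) ≡ p * q ^ suc (k + k)
  pairs-diagonal k = pairs≡lowPairsFormula 0 (suc k)

  pairs-subdiagonal : ∀ k → pairs (suc k) k ≡ lowPairsFormula (suc k) k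
  pairs-subdiagonal k = pairs≡lowPairsFormula 1 k

  ν : ∀ {a} → Vec Carrier a → ℕ
  ν f = 𝟙≢ 0# (constTerm (monic f))

  pairsʳ : ℕ → ℕ → ℕ
  pairsʳ a b = ∑Vec a (λ f → ∑Vec b (λ g → ν g * χ f g))

  pairsˡʳ : ℕ → ℕ → ℕ
  pairsˡʳ a b = ∑Vec a (λ f → ∑Vec b (λ g → ν f * (ν g * χ f g)))

  χ-0∷ : ∀ {a b} (v : Vec Carrier a) (g : Vec Carrier b) → χ (0# ∷ v) g ≡ ν g * χ v g
  χ-0∷ v g = trans (𝟙-cong (Coprime-0∷ (monic v) (monic g)) (coprime? (monic (0# ∷ v)) g) (nonzero ×-dec coprime? (monic v) g))
                   (𝟙-× nonzero (coprime? (monic v) g))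
    where nonzero = ¬? (constTerm (monic g) ≟ 0#)

  pairs-suc : ∀ a b → pairs (suc a) b ≡ pairsʳ a b + pairsʳ b (suc a)
  pairs-suc a b = begin
    ∑ pairs-from
      ≡⟨ ∑-split 0# pairs-from ⟩
    pairs-from 0# + ∑ (λ c → 𝟙≢ 0# c * pairs-from c)
      ≡⟨ cong₂ _+_ (∑Vec-cong a (λ v → ∑Vec-cong b (χ-0∷ v)))
        (∑-cong (λ c → sym (∑Vec²-*ˡ a b (𝟙≢ 0# c) (λ v → χ (c ∷ v))))) ⟩
    pairsʳ a b + ∑Vec (suc a) (λ f → ∑Vec b (λ g → ν f * χ f g))
      ≡⟨ cong (pairsʳ a b +_) (∑Vec-comm (suc a) b (λ f g → ν f * χ f g)) ⟩
    pairsʳ a b + ∑Vec b (λ g → ∑Vec (suc a) (λ f → ν f * χ f g))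
      ≡⟨ cong (pairsʳ a b +_) (∑Vec-cong b (λ g → ∑Vec-cong (suc a) (λ f → cong (ν f *_) (χ-comm f g)))) ⟩
    pairsʳ a b + pairsʳ b (suc a) ∎
    where
    pairs-from : Carrier → ℕ
    pairs-from c = ∑Vec a (λ v → ∑Vec b (χ (c ∷ v)))

  pairsʳ-suc : ∀ a b → pairsʳ (suc a) b ≡ pairsʳ a b + pairsˡʳ (suc a) b
  pairsʳ-suc a b = begin
    ∑ pairsʳ-from
      ≡⟨ ∑-split 0# pairsʳ-from ⟩
    pairsʳ-from 0# + ∑ (λ c → 𝟙≢ 0# c * pairsʳ-from c)
      ≡⟨ cong₂ _+_ (∑Vec-cong a (λ v → ∑Vec-cong b (λ g → ν-χ-0∷ v g)))
        (∑-cong (λ c → sym (∑Vec²-*ˡ a b (𝟙≢ 0# c) (λ v g → ν g * χ (c ∷ v) g)))) ⟩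
    pairsʳ a b + pairsˡʳ (suc a) b ∎
    where
    pairsʳ-from : Carrier → ℕ
    pairsʳ-from c = ∑Vec a (λ v → ∑Vec b (λ g → ν g * χ (c ∷ v) g))
    ν-χ-0∷ : ∀ v (g : Vec Carrier b) → ν g * χ (0# ∷ v) g ≡ ν g * χ v g
    ν-χ-0∷ v g = trans (cong (ν g *_) (χ-0∷ v g)) (𝟙-idem (¬? (constTerm (monic g) ≟ 0#)) (χ v g))

  +-rotate : ∀ x y z → x + (y + z) ≡ (z + x) + y
  +-rotate = solve-∀

  pairsʳ-diagonal-step : ∀ k → pairsʳ (suc k) (suc k) + pairs (suc k) k ≡ pairs (suc k) (suc k) + pairsʳ k k
  pairsʳ-diagonal-step k = begin
    pairsʳ (suc k) (suc k) + pairs (suc k) k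
      ≡⟨ cong (pairsʳ (suc k) (suc k) +_) (pairs-suc k k) ⟩
    pairsʳ (suc k) (suc k) + (pairsʳ k k + pairsʳ k (suc k))
      ≡⟨ +-rotate (pairsʳ (suc k) (suc k)) (pairsʳ k k) (pairsʳ k (suc k)) ⟩
    (pairsʳ k (suc k) + pairsʳ (suc k) (suc k)) + pairsʳ k k
      ≡⟨ cong (_+ pairsʳ k k) (pairs-suc k (suc k)) ⟨
    pairs (suc k) (suc k) + pairsʳ k k ∎

  pairsˡʳ-diagonal-step : ∀ k → pairsˡʳ (suc k) (suc k) + pairs (suc k) k ≡ pairsʳ (suc k) (suc k) + pairsʳ k k
  pairsˡʳ-diagonal-step k = begin
    pairsˡʳ (suc k) (suc k) + pairs (suc k) k
      ≡⟨ cong (pairsˡʳ (suc k) (suc k) +_) (pairs-suc k k) ⟩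
    pairsˡʳ (suc k) (suc k) + (pairsʳ k k + pairsʳ k (suc k))
      ≡⟨ +-rotate (pairsˡʳ (suc k) (suc k)) (pairsʳ k k) (pairsʳ k (suc k)) ⟩
    (pairsʳ k (suc k) + pairsˡʳ (suc k) (suc k)) + pairsʳ k k
      ≡⟨ cong (_+ pairsʳ k k) (pairsʳ-suc k (suc k)) ⟨
    pairsʳ (suc k) (suc k) + pairsʳ k k ∎

  evenPowerSum : ℕ → ℕ
  evenPowerSum zero    = 0
  evenPowerSum (suc k) = q ^ (k + k) + evenPowerSum k

  q^2k≡1+[q²-1]*evenPowerSum : ∀ k → q ^ (k + k) ≡ suc (p * suc q * evenPowerSum k)
  q^2k≡1+[q²-1]*evenPowerSum zero    = cong suc (sym (ℕₚ.*-zeroʳ (p * suc q)))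
  q^2k≡1+[q²-1]*evenPowerSum (suc k) rewrite ℕₚ.+-suc k k | q^2k≡1+[q²-1]*evenPowerSum k = identity r (evenPowerSum k)
    where
    identity : ∀ r G → let p = suc r ; q = suc p ; Y = suc (p * suc q * G) in q * (q * Y) ≡ suc (p * suc q * (Y + G))
    identity = solve-∀

  pairsʳFormula : ℕ → ℕ
  pairsʳFormula zero    = 1
  pairsʳFormula (suc k) = p * p * evenPowerSum (suc k)

  pairsʳFormula-step : ∀ k → pairsʳFormula (suc k) + lowPairsFormula (suc k) k ≡ p * q ^ suc (k + k) + pairsʳFormula k
  pairsʳFormula-step zero = identity r
    where
    identity : ∀ r → let p = suc r ; q = suc p in p * p * (1 + 0) + q * 1 ≡ p * (q * 1) + 1
    identity = solve-∀
  pairsʳFormula-step (suc k) rewrite ℕₚ.+-suc k k = identity r (q ^ (k + k)) (evenPowerSum (suc k))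
    where
    identity : ∀ r Y G → let p = suc r ; q = suc p in
               p * p * (q * (q * Y) + G) + p * (q * (q * Y)) ≡ p * (q * (q * (q * Y))) + p * p * G
    identity = solve-∀

  pairsʳ-diagonal : ∀ k → pairsʳ k k ≡ pairsʳFormula k
  pairsʳ-diagonal zero = cong₂ _*_ (𝟙-yes (0≢1 ∘ sym) (¬? (1# ≟ 0#))) (𝟙-yes (Coprime-[1#]ˡ [ 1# ]) (coprime? [ 1# ] []))
  pairsʳ-diagonal (suc k) = ℕₚ.+-cancelʳ-≡ (pairs (suc k) k) _ _ (begin
    pairsʳ (suc k) (suc k) + pairs (suc k) k            ≡⟨ pairsʳ-diagonal-step k ⟩
    pairs (suc k) (suc k) + pairsʳ k k                  ≡⟨ cong₂ _+_ (pairs-diagonal k) (pairsʳ-diagonal k) ⟩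
    p * q ^ suc (k + k) + pairsʳFormula k               ≡⟨ pairsʳFormula-step k ⟨
    pairsʳFormula (suc k) + lowPairsFormula (suc k) k   ≡⟨ cong (pairsʳFormula (suc k) +_) (pairs-subdiagonal k) ⟨
    pairsʳFormula (suc k) + pairs (suc k) k             ∎)

  pairsˡʳFormula-step : ∀ k → pairsʳFormula (suc k) + pairsʳFormula k
                                ≡ (q * p ^ 3 * evenPowerSum k + p * r) + lowPairsFormula (suc k) k
  pairsˡʳFormula-step zero = identity r
    where
    identity : ∀ r → let p = suc r ; q = suc p ; p³ = p * (p * (p * 1)) in p * p * (1 + 0) + 1 ≡ (q * p³ * 0 + p * r) + q * 1
    identity = solve-∀
  pairsˡʳFormula-step (suc k) rewrite ℕₚ.+-suc k k | q^2k≡1+[q²-1]*evenPowerSum k = identity r (evenPowerSum k)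
    where
    identity : ∀ r G → let p = suc r ; q = suc p ; p³ = p * (p * (p * 1)) ; Y = suc (p * suc q * G) in
               p * p * (q * (q * Y) + (Y + G)) + p * p * (Y + G) ≡ (q * p³ * (Y + G) + p * r) + p * (q * (q * Y))
    identity = solve-∀

  pairsˡʳ-diagonal : ∀ k → pairsˡʳ (suc k) (suc k) ≡ q * p ^ 3 * evenPowerSum k + p * r
  pairsˡʳ-diagonal k = ℕₚ.+-cancelʳ-≡ (pairs (suc k) k) _ _ (begin
    pairsˡʳ (suc k) (suc k) + pairs (suc k) k
      ≡⟨ pairsˡʳ-diagonal-step k ⟩
    pairsʳ (suc k) (suc k) + pairsʳ k k
      ≡⟨ cong₂ _+_ (pairsʳ-diagonal (suc k)) (pairsʳ-diagonal k) ⟩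
    pairsʳFormula (suc k) + pairsʳFormula k
      ≡⟨ pairsˡʳFormula-step k ⟩
    (q * p ^ 3 * evenPowerSum k + p * r) + lowPairsFormula (suc k) k
      ≡⟨ cong (q * p ^ 3 * evenPowerSum k + p * r +_) (pairs-subdiagonal k) ⟨
    (q * p ^ 3 * evenPowerSum k + p * r) + pairs (suc k) k ∎)

  pairsˡʳ-diagonal-formula : ∀ k → pairsˡʳ (suc k) (suc k) * (q ^ 2 ∸ 1)
                             ≡ q * (q ∸ 1) ^ 3 * (q ^ (2 * suc k ∸ 2) ∸ 1) + (q ∸ 1) * (q ∸ 2) * (q ^ 2 ∸ 1)
  pairsˡʳ-diagonal-formula k = begin
    pairsˡʳ (suc k) (suc k) * (q ^ 2 ∸ 1)
      ≡⟨ cong₂ _*_ (pairsˡʳ-diagonal k) q²∸1 ⟩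
    (q * p ^ 3 * G + p * r) * (p * suc q)
      ≡⟨ distribute r G ⟩
    q * p ^ 3 * (p * suc q * G) + p * r * (p * suc q)
      ≡⟨ cong₂ (λ x y → q * p ^ 3 * x + p * r * y) q^[2n-2]∸1 q²∸1 ⟨
    q * p ^ 3 * (q ^ (2 * suc k ∸ 2) ∸ 1) + p * r * (q ^ 2 ∸ 1) ∎
    where
    G = evenPowerSum k
    q²∸1 : q ^ 2 ∸ 1 ≡ p * suc q
    q²∸1 = cong (_∸ 1) (square r)
      where
      square : ∀ r → let p = suc r ; q = suc p in q * (q * 1) ≡ suc (p * suc q)
      square = solve-∀
    q^[2n-2]∸1 : q ^ (2 * suc k ∸ 2) ∸ 1 ≡ p * suc q * G
    q^[2n-2]∸1 = trans (cong (λ e → q ^ (e ∸ 2) ∸ 1) (double k)) (cong (_∸ 1) (q^2k≡1+[q²-1]*evenPowerSum k))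
      where
      double : ∀ k → 2 * suc k ≡ 2 + (k + k)
      double = solve-∀
    distribute : ∀ r G → let p = suc r ; q = suc p ; p³ = p * (p * (p * 1)) in
                 (q * p³ * G + p * r) * (p * suc q) ≡ q * p³ * (p * suc q * G) + p * r * (p * suc q)
    distribute = solve-∀

  NonzeroConstCoprime : ∀ {a b} → Vec Carrier a × Vec Carrier b → Set
  NonzeroConstCoprime (f , g) = (constTerm (monic f) ≢ 0#) × (constTerm (monic g) ≢ 0#) × Coprime (monic f) (monic g)

  nonzeroConstCoprime? : ∀ {a b} → Decidable (NonzeroConstCoprime {a} {b})
  nonzeroConstCoprime? (f , g) = ¬? (constTerm (monic f) ≟ 0#) ×-dec ¬? (constTerm (monic g) ≟ 0#) ×-dec coprime? (monic f) g

  pairsˡʳ≡length : ∀ n → length (pairsSatisfying n n nonzeroConstCoprime?) ≡ pairsˡʳ n n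
  pairsˡʳ≡length n = trans (length-pairsSatisfying n n nonzeroConstCoprime?) (∑Vec-cong n (λ f → ∑Vec-cong n (λ g →
    trans (𝟙-× (nonzero f) _) (cong (ν f *_) (𝟙-× (nonzero g) (coprime? (monic f) g))))))
    where
    nonzero : (h : Vec Carrier n) → Dec (constTerm (monic h) ≢ 0#)
    nonzero h = ¬? (constTerm (monic h) ≟ 0#)

¬FiniteField-0 : ¬ FiniteField 0
¬FiniteField-0 F with Inverse.to (FiniteField.card F) (FiniteField.0# F)
... | ()

¬FiniteField-1 : ¬ FiniteField 1
¬FiniteField-1 F = 0≢1 (begin
  0#             ≡⟨ strictlyInverseʳ 0# ⟨
  from (to 0#)   ≡⟨ cong from (Fin1-irrelevant (to 0#) (to 1#)) ⟩
  from (to 1#)   ≡⟨ strictlyInverseʳ 1# ⟩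
  1#             ∎)
  where
  open FiniteField F
  open Inverse card
  open ≡-Reasoning
  Fin1-irrelevant : (i j : Fin 1) → i ≡ j
  Fin1-irrelevant Fin.zero Fin.zero = refl

open import Data.Nat using (_≤_; _+_; _*_; _∸_; _^_)

theorem2 : (q : ℕ) (F : FiniteField q) (n : ℕ) → 1 ≤ n →
    Σ (List (Vec (FiniteField.Carrier F) n × Vec (FiniteField.Carrier F) n)) (λ L →
         Unique L
         × (∀ (f g : Vec (FiniteField.Carrier F) n) →
              ((f , g) ∈ L) ⇔ ((Poly.constTerm F (Poly.monic F f) ≢ FiniteField.0# F) × (Poly.constTerm F (Poly.monic F g) ≢ FiniteField.0# F) × Poly.Coprime F (Poly.monic F f) (Poly.monic F g)))
         × (length L * (q ^ 2 ∸ 1) ≡ q * (q ∸ 1) ^ 3 * (q ^ (2 * n ∸ 2) ∸ 1) + (q ∸ 1) * (q ∸ 2) * (q ^ 2 ∸ 1)))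
theorem2 zero          F _       _ = ⊥-elim (¬FiniteField-0 F)
theorem2 (suc zero)    F _       _ = ⊥-elim (¬FiniteField-1 F)
theorem2 (suc (suc r)) F (suc k) _ =
  L , pairsSatisfying-unique n n nonzeroConstCoprime? , ∈-pairsSatisfying n n nonzeroConstCoprime? , (begin
    length L * (q ^ 2 ∸ 1)               ≡⟨ cong (_* (q ^ 2 ∸ 1)) (pairsˡʳ≡length n) ⟩
    pairsˡʳ n n * (q ^ 2 ∸ 1)            ≡⟨ pairsˡʳ-diagonal-formula k ⟩
    q * (q ∸ 1) ^ 3 * (q ^ (2 * n ∸ 2) ∸ 1) + (q ∸ 1) * (q ∸ 2) * (q ^ 2 ∸ 1) ∎)
  where
  open Counting F
  open FiniteSums (FiniteField.card F)
  open ≡-Reasoning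
  n = suc k
  L = pairsSatisfying n n nonzeroConstCoprime?
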